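{- The divisibility partial order on the positive integers, in which $n\leq_d m$ if and only if $m$ divides $n$, is future-finite-universal: every countable partial order in which every up-set is finite embeds into it.
   Context: A countable partial order is future-finite if for every element $x$ the set $\{y: x\leq y\}$ is finite. A partial order is future-finite-universal if it contains every countable future-finite partial order as a suborder (i.e. there is an injective map $E$ with $x\leq y$ iff $E(x)\leq E(y)$). -}

module Defs where

open import Level using (Level; _⊔_; suc)
open import Data.Nat using (ℕ; NonZero)
open import Data.Nat.Divisibility using (_∣_)
open import Data.List using (List)
open import Data.List.Membership.Propositional using (_∈_)
open import Data.Product using (Σ; ∃; _×_)
open import Function.Definitions using (Injective)
open import Relation.Binary.PropositionalEquality using (_≡_)
open import Relation.Binary.Structures using (IsPartialOrder)

Countable : (A : Set) → Set
Countable A = Σ (A → ℕ) λ f → Injective _≡_ _≡_ f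

FutureFinite : {A : Set} → (A → A → Set) → Set
FutureFinite {A} _≤_ = ∀ x → Σ (List A) λ L → ∀ y → ((x ≤ y → y ∈ L) × (y ∈ L → x ≤ y))

_≤d_ : ℕ → ℕ → Set
n ≤d m = m ∣ n

EmbedsInDivOrder : {A : Set} → (A → A → Set) → Set
EmbedsInDivOrder {A} _≤_ =
  Σ (A → ℕ) λ E →
    (∀ x → NonZero (E x)) ×
    Injective _≡_ _≡_ E ×
    (∀ x y → ((x ≤ y → E x ≤d E y) × (E x ≤d E y → x ≤ y)))

module Submission where

open import Defs
open import Relation.Binary.PropositionalEquality using (_≡_)
open import Relation.Binary.Structures using (IsPartialOrder)

open import Relation.Binary.PropositionalEquality using (refl; sym; subst; subst₂)
open import Function using (_∘_)
open import Data.Nat using (ℕ; zero; suc; _*_; _≤_; _<_; _≤′_; ≤′-refl; ≤′-step; _⊔_; s≤s; NonZero; >-nonZero; >-nonZero⁻¹; _≟_; _!; _<?_; z<s)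
open import Data.Nat.Properties
  using (+-comm; 1≤n!; m*n≢0; <-trans; <-cmp; <⇒≢; <⇒≱; ≮⇒≥; ≤-trans; ≤⇒≤′; ≤′⇒≤
        ; m≤n⇒m<n∨m≡n; m≤m+n; m≤n+m; m≤m⊔n; m≤n⊔m)
open import Data.Nat.Divisibility
  using (_∣_; ∣-refl; ∣-trans; ∣-reflexive; ∣1⇒≡1; ∣m+n∣m⇒∣n; m∣m*n; ∣n⇒∣m*n; *-monoʳ-∣; m≤n⇒m!∣n!)
open import Data.Nat.Primality
  using (Prime; prime[2]; ¬prime[1]; prime⇒nonZero; prime⇒irreducible; euclidsLemma)
open import Data.Nat.Primality.Factorisation using (factorise)
open import Data.Nat.ListAction using (sum)
open import Data.Bool using (Bool; true; false; T)
open import Data.Empty using (⊥-elim)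
open import Data.Product using (∃-syntax; _×_; _,_; proj₁; proj₂)
open import Data.Sum using (inj₁; inj₂)
open import Data.List using (List; []; _∷_; map)
open import Data.List.Relation.Unary.All using (_∷_)
open import Data.List.Relation.Unary.Any using (here; there)
open import Data.List.Membership.Propositional using (_∈_)
open import Data.List.Membership.Propositional.Properties using (∈-map⁺; ∈-map⁻)
open import Data.List.Membership.DecPropositional _≟_ using (_∈?_)
open import Data.List.Relation.Binary.Subset.Propositional using (_⊆_)
import Data.List.Relation.Binary.Subset.Propositional.Properties as ⊆
open import Relation.Nullary using (yes; no)
open import Relation.Binary.Definitions using (tri<; tri≈; tri>)
open import Relation.Nullary.Decidable using (isYes; toWitness; fromWitness)

-- A finite set S of naturals is coded by the squarefree number ∏_{k ∈ S} p_k for a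
-- fixed injective sequence of primes p_k, so that inclusion of sets becomes
-- divisibility and k ∈ S is read off as p_k ∣ code S. An element x of the order is
-- sent to the code of its (finite) up-set, renamed into ℕ by the countability
-- injection: x ≤ y shrinks the up-set, and y lies in the up-set of x exactly when
-- the prime of y divides the code of x.

∃-prime-∣ : ∀ n → 1 < n → ∃[ p ] Prime p × p ∣ n
∃-prime-∣ n 1<n with factorise n {{>-nonZero (<-trans z<s 1<n)}}
... | record { factors = [] ; isFactorisation = n≡1 } = ⊥-elim (<⇒≢ 1<n (sym n≡1))
... | record { factors = p ∷ ps ; isFactorisation = n≡p*ps ; factorsPrime = prime[p] ∷ _ } =
  p , prime[p] , subst (p ∣_) (sym n≡p*ps) (m∣m*n _)

1≤m≤n⇒m∣n! : ∀ {m n} → 1 ≤ m → m ≤ n → m ∣ n !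
1≤m≤n⇒m∣n! {suc k} _ m≤n = ∣-trans (m∣m*n (k !)) (m≤n⇒m!∣n! m≤n)

prime∣1+n!⇒n<p : ∀ {p} n → Prime p → p ∣ suc (n !) → n < p
prime∣1+n!⇒n<p {p} n prime[p] p∣1+n! with n <? p
... | yes n<p = n<p
... | no n≮p = ⊥-elim (¬prime[1] (subst Prime (∣1⇒≡1 p∣1) prime[p]))
  where
  p∣1 : p ∣ 1
  p∣1 = ∣m+n∣m⇒∣n (subst (p ∣_) (+-comm 1 (n !)) p∣1+n!)
          (1≤m≤n⇒m∣n! (>-nonZero⁻¹ p {{prime⇒nonZero prime[p]}}) (≮⇒≥ n≮p))

∃-prime> : ∀ n → ∃[ p ] Prime p × n < p
∃-prime> n with ∃-prime-∣ (suc (n !)) (s≤s (1≤n! n))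
... | p , prime[p] , p∣1+n! = p , prime[p] , prime∣1+n!⇒n<p n prime[p] p∣1+n!

primeSeq : ℕ → ℕ
primeSeq zero = 2
primeSeq (suc k) = proj₁ (∃-prime> (primeSeq k))

primeSeq-prime : ∀ k → Prime (primeSeq k)
primeSeq-prime zero = prime[2]
primeSeq-prime (suc k) = proj₁ (proj₂ (∃-prime> (primeSeq k)))

primeSeq-<-suc : ∀ k → primeSeq k < primeSeq (suc k)
primeSeq-<-suc k = proj₂ (proj₂ (∃-prime> (primeSeq k)))

primeSeq-strictMono : ∀ {j k} → j < k → primeSeq j < primeSeq k
primeSeq-strictMono {j} {suc k} (s≤s j≤k) with m≤n⇒m<n∨m≡n j≤k
... | inj₁ j<k = <-trans (primeSeq-strictMono j<k) (primeSeq-<-suc k)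
... | inj₂ refl = primeSeq-<-suc k

primeSeq-injective : ∀ {j k} → primeSeq j ≡ primeSeq k → j ≡ k
primeSeq-injective {j} {k} eq with <-cmp j k
... | tri< j<k _ _ = ⊥-elim (<⇒≢ (primeSeq-strictMono j<k) eq)
... | tri≈ _ j≡k _ = j≡k
... | tri> _ _ k<j = ⊥-elim (<⇒≢ (primeSeq-strictMono k<j) (sym eq))

primeSeq-∣⇒≡ : ∀ {j k} → primeSeq j ∣ primeSeq k → j ≡ k
primeSeq-∣⇒≡ {j} {k} pⱼ∣pₖ with prime⇒irreducible (primeSeq-prime k) pⱼ∣pₖ
... | inj₁ pⱼ≡1 = ⊥-elim (¬prime[1] (subst Prime pⱼ≡1 (primeSeq-prime j)))
... | inj₂ pⱼ≡pₖ = primeSeq-injective pⱼ≡pₖ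

primeProduct : (ℕ → Bool) → ℕ → ℕ
primeProduct s zero = 1
primeProduct s (suc n) with s n
... | true = primeSeq n * primeProduct s n
... | false = primeProduct s n

primeProduct-nonZero : ∀ s n → NonZero (primeProduct s n)
primeProduct-nonZero s zero = _
primeProduct-nonZero s (suc n) with s n
... | true = m*n≢0 _ _ {{prime⇒nonZero (primeSeq-prime n)}} {{primeProduct-nonZero s n}}
... | false = primeProduct-nonZero s n

primeProduct-mono-∣ : ∀ {s t} → (∀ k → T (s k) → T (t k)) → ∀ n → primeProduct s n ∣ primeProduct t n
primeProduct-mono-∣ s⊆t zero = ∣-refl
primeProduct-mono-∣ {s} {t} s⊆t (suc n) with s n | t n | s⊆t n
... | true | true | _ = *-monoʳ-∣ (primeSeq n) (primeProduct-mono-∣ s⊆t n)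
... | true | false | tₙ = ⊥-elim (tₙ _)
... | false | true | _ = ∣n⇒∣m*n (primeSeq n) (primeProduct-mono-∣ s⊆t n)
... | false | false | _ = primeProduct-mono-∣ s⊆t n

primeProduct-stable : ∀ {s n m} → (∀ k → T (s k) → k < n) → n ≤ m → primeProduct s m ≡ primeProduct s n
primeProduct-stable {s} {n} s<n n≤m = go (≤⇒≤′ n≤m)
  where
  go : ∀ {m} → n ≤′ m → primeProduct s m ≡ primeProduct s n
  go ≤′-refl = refl
  go {suc m} (≤′-step n≤m) with s m in sₘ
  ... | true = ⊥-elim (<⇒≱ (s<n m (subst T (sym sₘ) _)) (≤′⇒≤ n≤m))
  ... | false = go n≤m

primeSeq-∣-primeProduct : ∀ {s j n} → T (s j) → j < n → primeSeq j ∣ primeProduct s n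
primeSeq-∣-primeProduct {s} {j} {suc n} sⱼ (s≤s j≤n) with m≤n⇒m<n∨m≡n j≤n | s n in sₙ
... | inj₁ j<n | true = ∣n⇒∣m*n (primeSeq n) (primeSeq-∣-primeProduct sⱼ j<n)
... | inj₁ j<n | false = primeSeq-∣-primeProduct sⱼ j<n
... | inj₂ refl | true = m∣m*n _
... | inj₂ refl | false = ⊥-elim (subst T sₙ sⱼ)

primeSeq-∣-primeProduct⁻ : ∀ {s j} n → primeSeq j ∣ primeProduct s n → T (s j)
primeSeq-∣-primeProduct⁻ {j = j} zero pⱼ∣1 =
  ⊥-elim (¬prime[1] (subst Prime (∣1⇒≡1 pⱼ∣1) (primeSeq-prime j)))
primeSeq-∣-primeProduct⁻ {s} {j} (suc n) pⱼ∣Π with s n in sₙ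
... | false = primeSeq-∣-primeProduct⁻ n pⱼ∣Π
... | true with euclidsLemma (primeSeq n) _ (primeSeq-prime j) pⱼ∣Π
...   | inj₁ pⱼ∣pₙ = subst (T ∘ s) (sym (primeSeq-∣⇒≡ pⱼ∣pₙ)) (subst T (sym sₙ) _)
...   | inj₂ pⱼ∣Π′ = primeSeq-∣-primeProduct⁻ n pⱼ∣Π′

∈⇒≤sum : ∀ {k ks} → k ∈ ks → k ≤ sum ks
∈⇒≤sum {ks = k ∷ ks} (here refl) = m≤m+n k (sum ks)
∈⇒≤sum {ks = k ∷ ks} (there k∈ks) = ≤-trans (∈⇒≤sum k∈ks) (m≤n+m (sum ks) k)

inList : List ℕ → ℕ → Bool
inList ks k = isYes (k ∈? ks)

-- The bound 1 + sum ks lies above every element of ks.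
code : List ℕ → ℕ
code ks = primeProduct (inList ks) (suc (sum ks))

code-stable : ∀ ks {m} → suc (sum ks) ≤ m → primeProduct (inList ks) m ≡ code ks
code-stable ks = primeProduct-stable {inList ks} (λ k k∈ks → s≤s (∈⇒≤sum (toWitness k∈ks)))

code-nonZero : ∀ ks → NonZero (code ks)
code-nonZero ks = primeProduct-nonZero (inList ks) (suc (sum ks))

code-mono-∣ : ∀ {ks ls} → ks ⊆ ls → code ks ∣ code ls
code-mono-∣ {ks} {ls} ks⊆ls =
  subst₂ _∣_ (code-stable ks (m≤m⊔n bₖₛ bₗₛ)) (code-stable ls (m≤n⊔m bₖₛ bₗₛ))
    (primeProduct-mono-∣ {inList ks} {inList ls}
      (λ k k∈ks → fromWitness (ks⊆ls (toWitness k∈ks))) (bₖₛ ⊔ bₗₛ))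
  where
  bₖₛ bₗₛ : ℕ
  bₖₛ = suc (sum ks)
  bₗₛ = suc (sum ls)

∈⇒primeSeq-∣-code : ∀ {k ks} → k ∈ ks → primeSeq k ∣ code ks
∈⇒primeSeq-∣-code {ks = ks} k∈ks =
  primeSeq-∣-primeProduct {inList ks} (fromWitness k∈ks) (s≤s (∈⇒≤sum k∈ks))

primeSeq-∣-code⇒∈ : ∀ {k ks} → primeSeq k ∣ code ks → k ∈ ks
primeSeq-∣-code⇒∈ {ks = ks} pₖ∣code =
  toWitness (primeSeq-∣-primeProduct⁻ {inList ks} (suc (sum ks)) pₖ∣code)

lemma6 : (A : Set) (_≤_ : A → A → Set) →
         IsPartialOrder _≡_ _≤_ →
         Countable A →
         FutureFinite _≤_ →
         EmbedsInDivOrder _≤_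
lemma6 A _≤_ isPO (index , index-injective) futureFinite =
  E , code-nonZero ∘ names , E-injective , λ x y → ≤⇒∣ , ∣⇒≤
  where
  open IsPartialOrder isPO using () renaming (refl to ≤ᴬ-refl; trans to ≤ᴬ-trans; antisym to ≤ᴬ-antisym)

  upSet : A → List A
  upSet x = proj₁ (futureFinite x)

  ≤⇒∈upSet : ∀ {x y} → x ≤ y → y ∈ upSet x
  ≤⇒∈upSet {x} {y} = proj₁ (proj₂ (futureFinite x) y)

  ∈upSet⇒≤ : ∀ {x y} → y ∈ upSet x → x ≤ y
  ∈upSet⇒≤ {x} {y} = proj₂ (proj₂ (futureFinite x) y)

  names : A → List ℕ
  names x = map index (upSet x)

  E : A → ℕ
  E x = code (names x)

  ≤⇒∣ : ∀ {x y} → x ≤ y → E y ∣ E x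
  ≤⇒∣ x≤y = code-mono-∣ (⊆.map⁺ index (λ z∈upSet-y → ≤⇒∈upSet (≤ᴬ-trans x≤y (∈upSet⇒≤ z∈upSet-y))))

  ∣⇒≤ : ∀ {x y} → E y ∣ E x → x ≤ y
  ∣⇒≤ {y = y} Ey∣Ex with ∈-map⁻ index (primeSeq-∣-code⇒∈ (∣-trans pᵢ∣Ey Ey∣Ex))
    where
    pᵢ∣Ey : primeSeq (index y) ∣ E y
    pᵢ∣Ey = ∈⇒primeSeq-∣-code (∈-map⁺ index (≤⇒∈upSet ≤ᴬ-refl))
  ... | z , z∈upSet , iy≡iz with index-injective iy≡iz
  ... | refl = ∈upSet⇒≤ z∈upSet

  E-injective : ∀ {x y} → E x ≡ E y → x ≡ y
  E-injective Ex≡Ey = ≤ᴬ-antisym (∣⇒≤ (∣-reflexive (sym Ex≡Ey))) (∣⇒≤ (∣-reflexive Ex≡Ey))
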